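{- Let $T$ be a tree of order $n$ and let $P=\{S_1,S_2,S_3\}$ be a stable $3$-partition of $T$ with $S_1,S_2,S_3$ all nonempty. Then the degree of $P$ in $\mathcal{B}_3(T)$ is at most $n-1$.
   Context: A stable $k$-partition of a graph $G$ is a multiset of $k$ independent sets of $G$ (some possibly empty) partitioning $V(G)$; for $v\in V(G)$, $P-v$ is obtained by deleting $v$ from its part. The Bell $k$-coloring graph $\mathcal{B}_k(G)$ has vertex set the stable $k$-partitions of $G$, with distinct $P,Q$ adjacent iff $P-v=Q-v$ for some $v\in V(G)$. -}

module Defs where

open import Level using (0ℓ)
open import Data.Nat using (ℕ; _≤_; _∸_)
open import Data.Fin using (Fin)
open import Data.List using (List; []; _∷_; _++_; [_]; length)
open import Data.List.Relation.Unary.All using (All)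
open import Data.List.Relation.Unary.AllPairs using (AllPairs)
open import Data.List.Relation.Unary.Linked using (Linked)
open import Data.List.Relation.Unary.Unique.Propositional using (Unique)
open import Data.Product using (Σ; _×_; ∃)
open import Data.Sum using (_⊎_)
open import Relation.Binary.PropositionalEquality using (_≡_; _≢_)
open import Relation.Nullary using (¬_)
open import Function.Bundles using (_⇔_)
open import Function.Definitions using (Surjective)

record Graph (n : ℕ) : Set₁ where
  field
    Adj     : Fin n → Fin n → Set
    sym     : ∀ {u v} → Adj u v → Adj v u
    irrefl  : ∀ {u} → ¬ Adj u u
open Graph public

module _ {n : ℕ} (G : Graph n) where

  Connected : Set
  Connected = ∀ u v → u ≡ v ⊎ Σ (List (Fin n)) (λ ws → Linked (Adj G) (u ∷ ws ++ [ v ]))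

  HasCycle : Set
  HasCycle = Σ (Fin n) λ x → Σ (List (Fin n)) λ ys →
               (2 ≤ length ys) × Unique (x ∷ ys) × Linked (Adj G) (x ∷ ys ++ [ x ])

  IsTree : Set
  IsTree = (1 ≤ n) × Connected × ¬ HasCycle

  -- A k-colouring c : Fin n → Fin k encodes the stable k-partition
  -- {c⁻¹(0), …, c⁻¹(k-1)} (a multiset of k independent sets, some possibly empty).
  Proper : {k : ℕ} → (Fin n → Fin k) → Set
  Proper c = ∀ {u v} → Adj G u v → c u ≢ c v

-- two colourings describe the same partition (multiset of parts) iff same kernel
SamePartition : {n k : ℕ} → (Fin n → Fin k) → (Fin n → Fin k) → Set
SamePartition c d = ∀ u w → (c u ≡ c w) ⇔ (d u ≡ d w)

AgreeOffVertex : {n k : ℕ} → (Fin n → Fin k) → (Fin n → Fin k) → Fin n → Set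
AgreeOffVertex c d v = ∀ u w → u ≢ v → w ≢ v → (c u ≡ c w) ⇔ (d u ≡ d w)

BellAdj : {n k : ℕ} → (Fin n → Fin k) → (Fin n → Fin k) → Set
BellAdj c d = ¬ SamePartition c d × ∃ (AgreeOffVertex c d)

DegreeAtMost : {n : ℕ} → Graph n → (k : ℕ) → (Fin n → Fin k) → ℕ → Set
DegreeAtMost G k c m =
  (Qs : List (Fin _ → Fin k)) → All (Proper G) Qs → All (BellAdj c) Qs →
  AllPairs (λ d e → ¬ SamePartition d e) Qs → length Qs ≤ m

{-# OPTIONS --safe #-}
-- A neighbour Q of P in B₃(T) is obtained by moving a single vertex v. As all three
-- parts of P are nonempty, v has to join one of the two other parts of P, and since v
-- has a neighbour, lying in one of them, it can only join the other: Q is determined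
-- by v. A vertex with neighbours in both other parts cannot move at all, and such a
-- vertex exists because along a walk without one the colours alternate between two
-- values. So Q ↦ v is injective into V(T) minus a vertex.
module Submission where

open import Defs renaming (sym to Adj-sym)
open import Data.Nat using (ℕ; suc; _∸_; _≤_; s<s)
open import Data.Nat.Properties using (≮⇒≥; <-irrefl; <⇒≤pred)
open import Data.Fin using (Fin; zero; suc) renaming (_<_ to _<ᶠ_)
open import Data.Fin.Properties using (_≟_; any?; pigeonhole)
open import Data.List using (List; []; _∷_; _++_; [_]; length; lookup)
open import Data.List.Membership.Propositional.Properties using (∈-lookup)
open import Data.List.Relation.Unary.All as All using (All; []; _∷_)
open import Data.List.Relation.Unary.Any as Any using (Any; here; there)
open import Data.List.Relation.Unary.Any.Properties using (++⁺ʳ)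
open import Data.List.Relation.Unary.AllPairs using (AllPairs; []; _∷_)
open import Data.List.Relation.Unary.Linked using (Linked; _∷_)
open import Data.List.Relation.Unary.Unique.Propositional using (Unique)
open import Data.Product using (∃; ∃₂; _×_; _,_; proj₁; proj₂)
open import Data.Sum using (inj₁; inj₂)
open import Function.Bundles using (_⇔_; mk⇔; Equivalence)
open import Function.Consequences using (surjective⇒strictlySurjective)
open import Function.Definitions using (Surjective; StrictlySurjective)
import Function.Properties.Equivalence as ⇔
open import Relation.Binary.PropositionalEquality using (_≡_; _≢_; refl; sym; trans; cong; subst; ≢-sym)
open import Relation.Nullary using (¬_; yes; no; contradiction; contraposition)
open import Relation.Nullary.Decidable using (_×-dec_; ¬?; decidable-stable)

open Equivalence using (to; from)

unique⇒lookup-≢ : ∀ {A : Set} {xs : List A} → Unique xs →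
                  ∀ {i j} → i <ᶠ j → lookup xs i ≢ lookup xs j
unique⇒lookup-≢ (x∉xs ∷ _) {zero}  {suc j} _         = All.lookup x∉xs (∈-lookup j)
unique⇒lookup-≢ (_ ∷ xs!)  {suc i} {suc j} (s<s i<j) = unique⇒lookup-≢ xs! i<j

unique⇒length≤ : ∀ {n} {xs : List (Fin n)} → Unique xs → length xs ≤ n
unique⇒length≤ {xs = xs} xs! = ≮⇒≥ λ n<len →
  let i , j , i<j , xsᵢ≡xsⱼ = pigeonhole n<len (lookup xs) in unique⇒lookup-≢ xs! i<j xsᵢ≡xsⱼ

fin3-other : (x : Fin 3) → ∃ λ y → y ≢ x
fin3-other zero             = suc zero , λ ()
fin3-other (suc zero)       = zero , λ ()
fin3-other (suc (suc zero)) = zero , λ ()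

fin3-third : (x y : Fin 3) → x ≢ y → ∃ λ z → z ≢ x × z ≢ y
fin3-third zero             zero             x≢y = contradiction refl x≢y
fin3-third zero             (suc zero)       _   = suc (suc zero) , (λ ()) , (λ ())
fin3-third zero             (suc (suc zero)) _   = suc zero , (λ ()) , (λ ())
fin3-third (suc zero)       zero             _   = suc (suc zero) , (λ ()) , (λ ())
fin3-third (suc zero)       (suc zero)       x≢y = contradiction refl x≢y
fin3-third (suc zero)       (suc (suc zero)) _   = zero , (λ ()) , (λ ())
fin3-third (suc (suc zero)) zero             _   = suc zero , (λ ()) , (λ ())
fin3-third (suc (suc zero)) (suc zero)       _   = zero , (λ ()) , (λ ())
fin3-third (suc (suc zero)) (suc (suc zero)) x≢y = contradiction refl x≢y

fin3-third-unique : ∀ {x y z t : Fin 3} → x ≢ y → z ≢ x → z ≢ y → t ≢ x → t ≢ y → t ≡ z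
fin3-third-unique {z = z} {t} x≢y z≢x z≢y t≢x t≢y = decidable-stable (t ≟ z) λ t≢z →
  <-irrefl refl (unique⇒length≤
    ((x≢y ∷ ≢-sym z≢x ∷ ≢-sym t≢x ∷ []) ∷ (≢-sym z≢y ∷ ≢-sym t≢y ∷ []) ∷ (≢-sym t≢z ∷ []) ∷ [] ∷ []))

module _ {A B : Set} {L : A → B → Set} where

  labels : {xs : List A} → All (λ x → ∃ (L x)) xs → List B
  labels = All.reduce proj₁

  length-labels : {xs : List A} (ls : All (λ x → ∃ (L x)) xs) → length (labels ls) ≡ length xs
  length-labels []       = refl
  length-labels (_ ∷ ls) = cong suc (length-labels ls)

  labels-avoid : ∀ {P : A → Set} {b} → (∀ {x} → P x → ¬ L x b) →
                 ∀ {xs} → All P xs → (ls : All (λ x → ∃ (L x)) xs) → All (b ≢_) (labels ls)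
  labels-avoid excluded []         []             = []
  labels-avoid excluded (px ∷ pxs) ((_ , lx) ∷ ls) =
    (λ { refl → excluded px lx }) ∷ labels-avoid excluded pxs ls

  labels-unique : ∀ {R : A → A → Set} → (∀ {x y b} → L x b → L y b → ¬ R x y) →
                  ∀ {xs} → AllPairs R xs → (ls : All (λ x → ∃ (L x)) xs) → Unique (labels ls)
  labels-unique separated []         []             = []
  labels-unique separated (rs ∷ rss) ((_ , lx) ∷ ls) =
    labels-avoid (λ r ly → separated lx ly r) rs ls ∷ labels-unique separated rss ls

module _ {n : ℕ} (G : Graph n) where

  adj⇒≢ : ∀ {u v} → Adj G u v → v ≢ u
  adj⇒≢ uv refl = irrefl G uv

  walk-neighbour : ∀ {x y} ws → Linked (Adj G) (x ∷ ws ++ [ y ]) → ∃ (Adj G x)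
  walk-neighbour []      (xy ∷ _) = _ , xy
  walk-neighbour (w ∷ _) (xw ∷ _) = w , xw

  connected-walk : Connected G → ∀ {u v} → u ≢ v → ∃ λ ws → Linked (Adj G) (u ∷ ws ++ [ v ])
  connected-walk connected {u} {v} u≢v with connected u v
  ... | inj₁ u≡v = contradiction u≡v u≢v
  ... | inj₂ walk = walk

  Branching : ∀ {k} → (Fin n → Fin k) → Fin n → Set
  Branching c v = ∃₂ λ a b → Adj G v a × Adj G v b × c a ≢ c b

  -- Before the first branching vertex, the colours along the walk alternate between c a and c b.
  walk-branching : ∀ {k} (c : Fin n → Fin k) {a b} rest → Linked (Adj G) (a ∷ b ∷ rest) →
                   Any (λ w → c w ≢ c a × c w ≢ c b) rest → ∃ (Branching c)
  walk-branching c {a} {b} (r ∷ rest) (ab ∷ br ∷ walk) new-colour with c r ≟ c a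
  ... | no cr≢ca = b , a , r , Adj-sym G ab , br , ≢-sym cr≢ca
  ... | yes cr≡ca with new-colour
  ...   | here (cr≢ca , _) = contradiction cr≡ca cr≢ca
  ...   | there new-later  =
    walk-branching c rest (br ∷ walk)
      (Any.map (λ (cw≢ca , cw≢cb) → cw≢cb , λ cw≡cr → cw≢ca (trans cw≡cr cr≡ca)) new-later)

JoinsOtherPart : ∀ {n k} → (Fin n → Fin k) → (Fin n → Fin k) → Fin n → Set
JoinsOtherPart c d v = ∃ λ w → c w ≢ c v × d w ≡ d v

module _ {n k : ℕ} {c d : Fin n → Fin k} {v : Fin n} where

  agreeOff-sym : AgreeOffVertex c d v → AgreeOffVertex d c v
  agreeOff-sym c~d u w u≢v w≢v = ⇔.sym (c~d u w u≢v w≢v)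

  agreeOff-trans : ∀ {e} → AgreeOffVertex c d v → AgreeOffVertex d e v → AgreeOffVertex c e v
  agreeOff-trans c~d d~e u w u≢v w≢v = ⇔.trans (c~d u w u≢v w≢v) (d~e u w u≢v w≢v)

  agreeOff-≢ : AgreeOffVertex c d v → ∀ {u w} → u ≢ v → w ≢ v → c u ≢ c w → d u ≢ d w
  agreeOff-≢ c~d u≢v w≢v = contraposition (from (c~d _ _ u≢v w≢v))

  agreeOff⇒samePartition : AgreeOffVertex c d v → (∀ w → w ≢ v → (c v ≡ c w) ⇔ (d v ≡ d w)) →
                           SamePartition c d
  agreeOff⇒samePartition c~d at-v u w with u ≟ v | w ≟ v
  ... | yes refl | yes refl = mk⇔ (λ _ → refl) (λ _ → refl)
  ... | yes refl | no w≢v   = at-v w w≢v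
  ... | no u≢v   | yes refl = ⇔.trans (mk⇔ sym sym) (⇔.trans (at-v u u≢v) (mk⇔ sym sym))
  ... | no u≢v   | no w≢v   = c~d u w u≢v w≢v

  joined-part : AgreeOffVertex c d v → ((w , _) : JoinsOtherPart c d v) → ∀ {γ} → c w ≡ γ →
                ∀ u → u ≢ v → (d v ≡ d u) ⇔ (γ ≡ c u)
  joined-part c~d (w , cw≢cv , dw≡dv) cw≡γ u u≢v =
    mk⇔ (λ dv≡du → trans (sym cw≡γ) (from w~u (trans dw≡dv dv≡du)))
        (λ γ≡cu → trans (sym dw≡dv) (to w~u (trans cw≡γ γ≡cu)))
    where w~u = c~d w u (contraposition (cong c) cw≢cv) u≢v

ProperMoveAt : ∀ {n k} → Graph n → (Fin n → Fin k) → (Fin n → Fin k) → Fin n → Set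
ProperMoveAt T c d v = Proper T d × ¬ SamePartition c d × AgreeOffVertex c d v

joined-part-avoids-neighbours : ∀ {n k} (T : Graph n) {c d : Fin n → Fin k} {v a} →
                                Proper T d → AgreeOffVertex c d v →
                                ((w , _) : JoinsOtherPart c d v) → Adj T v a → c w ≢ c a
joined-part-avoids-neighbours T {c} d-proper c~d (w , cw≢cv , dw≡dv) va cw≡ca =
  d-proper va (trans (sym dw≡dv) (to (c~d _ _ (contraposition (cong c) cw≢cv) (adj⇒≢ T va)) cw≡ca))

module _ {n : ℕ} {c : Fin n → Fin 3} (c-onto : StrictlySurjective _≡_ c) where

  other-parts : ∀ v → ∃₂ λ p q → c p ≢ c v × c q ≢ c v × c p ≢ c q
  other-parts v with fin3-other (c v)
  ... | γ₁ , γ₁≢cv with fin3-third (c v) γ₁ (≢-sym γ₁≢cv) | c-onto γ₁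
  ...   | γ₂ , γ₂≢cv , γ₂≢γ₁ | p , refl with c-onto γ₂
  ...     | q , refl = p , q , γ₁≢cv , γ₂≢cv , ≢-sym γ₂≢γ₁

  -- The two other parts of c are nonempty, and d keeps them apart from each other and from
  -- the part of w; as v joins neither of them and there are only three colours, d v = d w.
  ¬joinsOtherPart⇒samePartition : ∀ {d v} → AgreeOffVertex c d v → ¬ JoinsOtherPart c d v →
                                  SamePartition c d
  ¬joinsOtherPart⇒samePartition {d} {v} c~d stays = agreeOff⇒samePartition c~d λ w w≢v →
    mk⇔ (keeps-own-part w w≢v)
        (λ dv≡dw → decidable-stable (c v ≟ c w) λ cv≢cw → stays (w , ≢-sym cv≢cw , sym dv≡dw))
    where
    keeps-own-part : ∀ w → w ≢ v → c v ≡ c w → d v ≡ d w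
    keeps-own-part w w≢v cv≡cw =
      let p , q , cp≢cv , cq≢cv , cp≢cq = other-parts v
          p≢v = contraposition (cong c) cp≢cv
          q≢v = contraposition (cong c) cq≢cv
      in fin3-third-unique (agreeOff-≢ c~d p≢v q≢v cp≢cq)
                           (agreeOff-≢ c~d w≢v p≢v (≢-sym (subst (c p ≢_) cv≡cw cp≢cv)))
                           (agreeOff-≢ c~d w≢v q≢v (≢-sym (subst (c q ≢_) cv≡cw cq≢cv)))
                           (λ dv≡dp → stays (p , cp≢cv , sym dv≡dp))
                           (λ dv≡dq → stays (q , cq≢cv , sym dv≡dq))

  moved⇒joinsOtherPart : ∀ {d v} → AgreeOffVertex c d v → ¬ SamePartition c d → JoinsOtherPart c d v
  moved⇒joinsOtherPart {d} {v} c~d c≁d with any? (λ w → ¬? (c w ≟ c v) ×-dec (d w ≟ d v))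
  ... | yes joins = joins
  ... | no stays  = contradiction (¬joinsOtherPart⇒samePartition c~d stays) c≁d

module ProperThreeColouring {n : ℕ} (T : Graph n) {c : Fin n → Fin 3}
                            (c-proper : Proper T c) (c-onto : StrictlySurjective _≡_ c) where

  has-neighbour : Connected T → ∀ v → ∃ (Adj T v)
  has-neighbour connected v =
    let p , _ , cp≢cv , _ = other-parts c-onto v
        ws , v⇝p = connected-walk T connected (contraposition (cong c) (≢-sym cp≢cv))
    in walk-neighbour T ws v⇝p

  moved-vertex-determines-move : ∀ {v a d e} → Adj T v a →
                                 ProperMoveAt T c d v → ProperMoveAt T c e v → SamePartition d e
  moved-vertex-determines-move va (d-proper , c≁d , c~d) (e-proper , c≁e , c~e) =
    agreeOff⇒samePartition (agreeOff-trans (agreeOff-sym c~d) c~e) λ w w≢v →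
      ⇔.trans (joined-part c~d joins-d same-target w w≢v) (⇔.sym (joined-part c~e joins-e refl w w≢v))
    where
    joins-d = moved⇒joinsOtherPart c-onto c~d c≁d
    joins-e = moved⇒joinsOtherPart c-onto c~e c≁e
    same-target : c (proj₁ joins-d) ≡ c (proj₁ joins-e)
    same-target = fin3-third-unique (c-proper va)
      (proj₁ (proj₂ joins-e)) (joined-part-avoids-neighbours T e-proper c~e joins-e va)
      (proj₁ (proj₂ joins-d)) (joined-part-avoids-neighbours T d-proper c~d joins-d va)

  branching-immovable : ∀ {v d} → Branching T c v → ¬ ProperMoveAt T c d v
  branching-immovable (a , b , va , vb , ca≢cb) (d-proper , c≁d , c~d) =
    cw≢cb (fin3-third-unique (c-proper va) (≢-sym (c-proper vb)) (≢-sym ca≢cb) cw≢cv cw≢ca)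
    where
    joins = moved⇒joinsOtherPart c-onto c~d c≁d
    cw≢cv = proj₁ (proj₂ joins)
    cw≢ca = joined-part-avoids-neighbours T d-proper c~d joins va
    cw≢cb = joined-part-avoids-neighbours T d-proper c~d joins vb

  branching-exists : Connected T → ∃ (Branching T c)
  branching-exists connected =
    let x , _ = c-onto zero
        b , xb = has-neighbour connected x
        γ , γ≢cx , γ≢cb = fin3-third (c x) (c b) (c-proper xb)
        z , cz≡γ = c-onto γ
        cz≢cx = subst (_≢ c x) (sym cz≡γ) γ≢cx
        cz≢cb = subst (_≢ c b) (sym cz≡γ) γ≢cb
        ws , x⇝z = connected-walk T connected (contraposition (cong c) (≢-sym cz≢cx))
    in walk-branching T c (ws ++ [ z ]) (Adj-sym T xb ∷ x⇝z) (++⁺ʳ ws (here (cz≢cb , cz≢cx)))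

  connected⇒degree≤ : Connected T → DegreeAtMost T 3 c (n ∸ 1)
  connected⇒degree≤ connected Qs Qs-proper Qs-adjacent Qs-distinct
    with v₀ , v₀-branching ← branching-exists connected =
    subst (_≤ n ∸ 1) (length-labels moves)
          (<⇒≤pred (unique⇒length≤ (v₀-unmoved ∷ moved-vertices-distinct)))
    where
    proper-move : ∀ {d} → Proper T d → BellAdj c d → ∃ (ProperMoveAt T c d)
    proper-move d-proper (c≁d , v , c~d) = v , d-proper , c≁d , c~d

    moves : All (λ d → ∃ (ProperMoveAt T c d)) Qs
    moves = All.zipWith {P = Proper T} (λ (d-proper , c~d) → proper-move d-proper c~d)
                        (Qs-proper , Qs-adjacent)

    v₀-unmoved : All (v₀ ≢_) (labels moves)
    v₀-unmoved = labels-avoid (λ _ → branching-immovable v₀-branching) moves moves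

    moved-vertices-distinct : Unique (labels moves)
    moved-vertices-distinct = labels-unique
      (λ {_} {_} {v} moved-d moved-e d≁e →
         d≁e (moved-vertex-determines-move (proj₂ (has-neighbour connected v)) moved-d moved-e))
      Qs-distinct moves

lemma5p2 : (n : ℕ) (T : Graph n) → IsTree T →
           (c : Fin n → Fin 3) → Proper T c → Surjective _≡_ _≡_ c →
           DegreeAtMost T 3 c (n ∸ 1)
lemma5p2 n T (_ , connected , _) c c-proper c-onto =
  ProperThreeColouring.connected⇒degree≤ T c-proper (surjective⇒strictlySurjective _≡_ refl c-onto)
    connected
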